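{- Let $M\in\mathbb{Z}^{r\times m}$ of rank $r$ satisfy $d_r(M)=1$. Then for every abelian group $G$ and every surjective homomorphism $\theta:G\to H$ onto an abelian group $H$, the homomorphism $\theta^m:G^m\to H^m$, $x\mapsto(\theta(x_1),\dots,\theta(x_m))$, maps $\ker_G M$ onto $\ker_H M$.
   Context: $d_r(M)$ is the gcd of the nonzero $r\times r$ minors of $M$. $\ker_G M=\{x\in G^m:Mx=0\}$. -}

module Defs where

open import Level using (Level)
open import Data.Nat as ℕ using (ℕ; zero; suc)
open import Data.Integer as ℤ using (ℤ; +_; -[1+_]; ∣_∣)
open import Data.Integer.Divisibility using () renaming (_∣_ to _∣ℤ_)
open import Data.Fin as Fin using (Fin; zero; suc; toℕ; punchIn)
open import Data.Fin.Base using (_<_)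
open import Data.Nat.Divisibility using (_∣_)
open import Data.Product using (Σ; ∃; _×_; _,_)
open import Relation.Nullary using (¬_)
open import Relation.Binary.PropositionalEquality using (_≡_)
open import Algebra.Bundles using (AbelianGroup)
open import Algebra.Morphism.Structures using (module GroupMorphisms)
import Algebra.Definitions.RawMonoid as RM

Matrix : ℕ → ℕ → Set
Matrix r m = Fin r → Fin m → ℤ

Σℤ : ∀ {n} → (Fin n → ℤ) → ℤ
Σℤ {zero}  f = + 0
Σℤ {suc n} f = f zero ℤ.+ Σℤ (λ i → f (suc i))

sgn : ℕ → ℤ
sgn zero          = + 1
sgn (suc zero)    = ℤ.- (+ 1)
sgn (suc (suc k)) = sgn k

det : ∀ {n} → Matrix n n → ℤ
det {zero}  A = + 1
det {suc n} A = Σℤ (λ j → sgn (toℕ j) ℤ.* A zero j ℤ.* det (λ i k → A (suc i) (punchIn j k)))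

IncreasingSel : ℕ → ℕ → Set
IncreasingSel r m = Σ (Fin r → Fin m) (λ σ → ∀ i j → i < j → σ i < σ j)

minor : ∀ {r m} → Matrix r m → IncreasingSel r m → ℤ
minor M (σ , _) = det (λ i j → M i (σ j))

IsGcdOfNonzeroMinors : ∀ {r m} → Matrix r m → ℕ → Set
IsGcdOfNonzeroMinors {r} {m} M d =
  (∀ (σ : IncreasingSel r m) → ¬ (minor M σ ≡ + 0) → d ∣ ∣ minor M σ ∣) ×
  (∀ (k : ℕ) → (∀ (σ : IncreasingSel r m) → ¬ (minor M σ ≡ + 0) → k ∣ ∣ minor M σ ∣) → k ∣ d)

-- M has rank r: its r rows are linearly independent (over ℤ, equivalently over ℚ).
HasFullRowRank : ∀ {r m} → Matrix r m → Set
HasFullRowRank {r} {m} M =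
  ∀ (c : Fin r → ℤ) → (∀ j → Σℤ (λ i → c i ℤ.* M i j) ≡ + 0) → ∀ i → c i ≡ + 0

module _ {c ℓ : Level} (G : AbelianGroup c ℓ) where
  open AbelianGroup G
  open RM rawMonoid using () renaming (_×_ to _×ℕ_)

  _·_ : ℤ → Carrier → Carrier
  (+ n)    · x = n ×ℕ x
  -[1+ n ] · x = (suc n ×ℕ x) ⁻¹

  ΣG : ∀ {n} → (Fin n → Carrier) → Carrier
  ΣG {zero}  f = ε
  ΣG {suc n} f = f zero ∙ ΣG (λ i → f (suc i))

  InKer : ∀ {r m} → Matrix r m → (Fin m → Carrier) → Set ℓ
  InKer M x = ∀ i → ΣG (λ j → M i j · x j) ≈ ε

IsHom : ∀ {c₁ ℓ₁ c₂ ℓ₂} (G : AbelianGroup c₁ ℓ₁) (H : AbelianGroup c₂ ℓ₂) →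
        (AbelianGroup.Carrier G → AbelianGroup.Carrier H) → Set _
IsHom G H θ = GroupMorphisms.IsGroupHomomorphism (AbelianGroup.rawGroup G) (AbelianGroup.rawGroup H) θ

-- Since d_r(M) = 1, Bézout gives integers c_τ with Σ_τ c_τ det M_τ = 1, where M_τ runs over the r × r
-- column selections of M. Spreading the adjugate of each M_τ into an m × r matrix and combining these with
-- the c_τ yields an integer right inverse N of M. Given y ∈ ker_H M, lift it to any x₀ ∈ G^m: then
-- z = M x₀ ∈ ker θ^r, so w = N z ∈ ker θ^m, and x = x₀ − w satisfies M x = z − M N z = 0 and θ^m x = y.

module Submission where

open import Defs
open import Function using (_∘_; const)
open import Data.Nat as ℕ using (ℕ; zero; suc)
open import Data.Nat.Divisibility using (_∣_; ∣-trans; ∣1⇒≡1)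
open import Data.Nat.GCD using (module GCD; module Bézout)
open import Data.Integer using (ℤ; +_; -[1+_]; -1ℤ; _+_; _*_; -_; ∣_∣)
open import Data.Integer.Properties
open import Data.Integer.Tactic.RingSolver using (solve-∀)
open import Data.Fin as Fin using (Fin; zero; suc; toℕ; punchIn; punchOut; finToFun; funToFin)
open import Data.Fin.Properties using (punchInᵢ≢i; punchIn-injective; punchIn-punchOut; finToFun-funToFin)
open import Data.Product using (∃; ∃₂; _×_; _,_; proj₁; proj₂)
open import Data.Vec.Functional using (updateAt)
open import Data.Vec.Functional.Properties
  using (updateAt-updates; updateAt-minimal; updateAt-commutes; map-updateAt-local)
open import Relation.Nullary using (yes; no; contradiction)
import Relation.Binary.PropositionalEquality as ≡
open ≡ using (_≡_; _≢_)
import Relation.Binary.Reasoning.Setoid as SetoidReasoning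
open import Algebra.Bundles using (AbelianGroup)
open import Algebra.Morphism.Structures using (module GroupMorphisms)
import Algebra.Properties.AbelianGroup as AbelianGroupProperties
import Algebra.Properties.CommutativeMonoid.Mult as CommutativeMonoidMult
import Algebra.Properties.CommutativeMonoid.Sum as CommutativeMonoidSum
open import Algebra.Properties.Semiring.Sum +-*-semiring
  using (sum; sum-syntax; sum-cong-≗; sum-replicate-zero; sum-remove; ∑-distrib-+; ∑-comm; *-distribˡ-sum)

module IntegerMatrices where

  open ≡
  open ≡-Reasoning

  Σℤ≡sum : ∀ {n} (f : Fin n → ℤ) → Σℤ f ≡ sum f
  Σℤ≡sum {zero}  f = refl
  Σℤ≡sum {suc n} f = cong (λ s → f zero + s) (Σℤ≡sum (f ∘ suc))

  sum-zero : ∀ {n} (f : Fin n → ℤ) → (∀ i → f i ≡ + 0) → sum f ≡ + 0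
  sum-zero {n} f f≗0 = trans (sum-cong-≗ f≗0) (sum-replicate-zero n)

  sum-linear : ∀ {n} a b (f g : Fin n → ℤ) →
               ∑[ i < n ] (a * f i + b * g i) ≡ a * sum f + b * sum g
  sum-linear {n} a b f g = begin
    ∑[ i < n ] (a * f i + b * g i)
      ≡⟨ ∑-distrib-+ (λ i → a * f i) (λ i → b * g i) ⟩
    ∑[ i < n ] (a * f i) + ∑[ i < n ] (b * g i)
      ≡⟨ sym (cong₂ _+_ (*-distribˡ-sum a f) (*-distribˡ-sum b g)) ⟩
    a * sum f + b * sum g ∎

  δ : ∀ {n} → Fin n → Fin n → ℤ
  δ i j with i Fin.≟ j
  ... | yes _ = + 1
  ... | no  _ = + 0

  δ-diag : ∀ {n} (i : Fin n) → δ i i ≡ + 1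
  δ-diag i with i Fin.≟ i
  ... | yes _   = refl
  ... | no  i≢i = contradiction refl i≢i

  δ-≢ : ∀ {n} {i j : Fin n} → i ≢ j → δ i j ≡ + 0
  δ-≢ {i = i} {j} i≢j with i Fin.≟ j
  ... | yes i≡j = contradiction i≡j i≢j
  ... | no  _   = refl

  δ-sym : ∀ {n} (i j : Fin n) → δ i j ≡ δ j i
  δ-sym i j with i Fin.≟ j
  ... | yes refl = sym (δ-diag i)
  ... | no  i≢j  = sym (δ-≢ (i≢j ∘ sym))

  sum-δ : ∀ {n} i (f : Fin n → ℤ) → ∑[ k < n ] (δ i k * f k) ≡ f i
  sum-δ {suc n} i f = begin
    ∑[ k < suc n ] (δ i k * f k)
      ≡⟨ sum-remove {i = i} (λ k → δ i k * f k) ⟩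
    δ i i * f i + ∑[ k < n ] (δ i (punchIn i k) * f (punchIn i k))
      ≡⟨ cong₂ _+_ (cong (_* f i) (δ-diag i))
                   (sum-zero _ (λ k → cong (_* f (punchIn i k)) (δ-≢ (punchInᵢ≢i i k ∘ sym)))) ⟩
    + 1 * f i + + 0
      ≡⟨ trans (+-identityʳ _) (*-identityˡ (f i)) ⟩
    f i ∎

  sum-δʳ : ∀ {n} i (f : Fin n → ℤ) → ∑[ k < n ] (f k * δ k i) ≡ f i
  sum-δʳ i f = trans (sum-cong-≗ (λ k → trans (*-comm (f k) _) (cong (_* f k) (δ-sym k i)))) (sum-δ i f)

  minor₀ : ∀ {n} → Matrix (suc n) (suc n) → Fin (suc n) → Matrix n n
  minor₀ A j i k = A (suc i) (punchIn j k)

  laplaceTerm : ∀ {n} → Matrix (suc n) (suc n) → Fin (suc n) → ℤ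
  laplaceTerm A j = sgn (toℕ j) * A zero j * det (minor₀ A j)

  det-expand : ∀ {n} (A : Matrix (suc n) (suc n)) → det A ≡ ∑[ j < suc n ] laplaceTerm A j
  det-expand A = Σℤ≡sum (laplaceTerm A)

  det-cong : ∀ {n} {A B : Matrix n n} → (∀ i k → A i k ≡ B i k) → det A ≡ det B
  det-cong {zero}  A≗B = refl
  det-cong {suc n} A≗B = Σℤ-cong λ j →
    cong₂ _*_ (cong (sgn (toℕ j) *_) (A≗B zero j)) (det-cong λ i k → A≗B (suc i) (punchIn j k))
    where
    Σℤ-cong : ∀ {m} {f g : Fin m → ℤ} → (∀ i → f i ≡ g i) → Σℤ f ≡ Σℤ g
    Σℤ-cong {f = f} {g} f≗g = trans (Σℤ≡sum f) (trans (sum-cong-≗ f≗g) (sym (Σℤ≡sum g)))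

  infixl 9 _[_]≔_
  _[_]≔_ : ∀ {n m} → Matrix n m → Fin n → (Fin m → ℤ) → Matrix n m
  A [ p ]≔ v = updateAt A p (const v)

  []≔-updates : ∀ {n m} (A : Matrix n m) p v k → (A [ p ]≔ v) p k ≡ v k
  []≔-updates A p v k = cong-app (updateAt-updates p A) k

  []≔-minimal : ∀ {n m} (A : Matrix n m) {p i} v → i ≢ p → ∀ k → (A [ p ]≔ v) i k ≡ A i k
  []≔-minimal A {p} {i} v i≢p k = cong-app (updateAt-minimal i p A i≢p) k

  []≔-cong : ∀ {n m} (A : Matrix n m) p {u w : Fin m → ℤ} → (∀ k → u k ≡ w k) →
             ∀ i k → (A [ p ]≔ u) i k ≡ (A [ p ]≔ w) i k
  []≔-cong A p {u} {w} u≗w i k with i Fin.≟ p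
  ... | yes refl = trans ([]≔-updates A i u k) (trans (u≗w k) (sym ([]≔-updates A i w k)))
  ... | no  i≢p  = trans ([]≔-minimal A u i≢p k) (sym ([]≔-minimal A w i≢p k))

  []≔-id : ∀ {n m} (A : Matrix n m) p v → (∀ k → v k ≡ A p k) → ∀ i k → (A [ p ]≔ v) i k ≡ A i k
  []≔-id A p v v≗Ap i k with i Fin.≟ p
  ... | yes refl = trans ([]≔-updates A i v k) (v≗Ap k)
  ... | no  i≢p  = []≔-minimal A v i≢p k

  minor₀-[]≔ : ∀ {n} (A : Matrix (suc (suc n)) (suc (suc n))) p v j i k →
               minor₀ (A [ suc p ]≔ v) j i k ≡ (minor₀ A j [ p ]≔ (v ∘ punchIn j)) i k
  minor₀-[]≔ A p v j i k = cong-app (map-updateAt-local {f = _∘ punchIn j} (A ∘ suc) p refl i) k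

  det-linear-termwise : ∀ {n} (A B C : Matrix (suc n) (suc n)) a b →
    (∀ j → laplaceTerm A j ≡ a * laplaceTerm B j + b * laplaceTerm C j) → det A ≡ a * det B + b * det C
  det-linear-termwise {n} A B C a b termwise = begin
    det A
      ≡⟨ det-expand A ⟩
    ∑[ j < suc n ] laplaceTerm A j
      ≡⟨ sum-cong-≗ termwise ⟩
    ∑[ j < suc n ] (a * laplaceTerm B j + b * laplaceTerm C j)
      ≡⟨ sum-linear a b (laplaceTerm B) (laplaceTerm C) ⟩
    a * ∑[ j < suc n ] laplaceTerm B j + b * ∑[ j < suc n ] laplaceTerm C j
      ≡⟨ sym (cong₂ (λ x y → a * x + b * y) (det-expand B) (det-expand C)) ⟩
    a * det B + b * det C ∎

  det-linear : ∀ {n} (A : Matrix n n) p a b (u w : Fin n → ℤ) →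
               det (A [ p ]≔ (λ k → a * u k + b * w k)) ≡ a * det (A [ p ]≔ u) + b * det (A [ p ]≔ w)
  det-linear {suc n} A zero a b u w =
    det-linear-termwise (A [ zero ]≔ (λ k → a * u k + b * w k)) (A [ zero ]≔ u) (A [ zero ]≔ w) a b
      λ j → distrib (sgn (toℕ j)) a b (u j) (w j) (det (minor₀ A j))
    where
    distrib : ∀ s a b x y d → s * (a * x + b * y) * d ≡ a * (s * x * d) + b * (s * y * d)
    distrib = solve-∀
  det-linear {suc (suc n)} A (suc p) a b u w =
    det-linear-termwise (A [ suc p ]≔ v) (A [ suc p ]≔ u) (A [ suc p ]≔ w) a b λ j → begin
      S j * det (minor₀ (A [ suc p ]≔ v) j)
        ≡⟨ cong (S j *_) (det-cong (minor₀-[]≔ A p v j)) ⟩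
      S j * det (minor₀ A j [ p ]≔ (v ∘ punchIn j))
        ≡⟨ cong (S j *_) (det-linear (minor₀ A j) p a b (u ∘ punchIn j) (w ∘ punchIn j)) ⟩
      S j * (a * det (minor₀ A j [ p ]≔ (u ∘ punchIn j)) + b * det (minor₀ A j [ p ]≔ (w ∘ punchIn j)))
        ≡⟨ distrib (S j) a b _ _ ⟩
      a * (S j * det (minor₀ A j [ p ]≔ (u ∘ punchIn j))) + b * (S j * det (minor₀ A j [ p ]≔ (w ∘ punchIn j)))
        ≡⟨ sym (cong₂ (λ x y → a * (S j * x) + b * (S j * y))
                      (det-cong (minor₀-[]≔ A p u j)) (det-cong (minor₀-[]≔ A p w j))) ⟩
      a * laplaceTerm (A [ suc p ]≔ u) j + b * laplaceTerm (A [ suc p ]≔ w) j ∎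
    where
    v : Fin (suc (suc n)) → ℤ
    v k = a * u k + b * w k
    S : Fin (suc (suc n)) → ℤ
    S j = sgn (toℕ j) * A zero j
    distrib : ∀ s a b x y → s * (a * x + b * y) ≡ a * (s * x) + b * (s * y)
    distrib = solve-∀

  det-additive : ∀ {n} (A : Matrix n n) p (u w : Fin n → ℤ) →
                 det (A [ p ]≔ (λ k → u k + w k)) ≡ det (A [ p ]≔ u) + det (A [ p ]≔ w)
  det-additive A p u w = begin
    det (A [ p ]≔ (λ k → u k + w k))
      ≡⟨ det-cong ([]≔-cong A p (λ k → sym (cong₂ _+_ (*-identityˡ (u k)) (*-identityˡ (w k))))) ⟩
    det (A [ p ]≔ (λ k → + 1 * u k + + 1 * w k))
      ≡⟨ det-linear A p (+ 1) (+ 1) u w ⟩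
    + 1 * det (A [ p ]≔ u) + + 1 * det (A [ p ]≔ w)
      ≡⟨ cong₂ _+_ (*-identityˡ (det (A [ p ]≔ u))) (*-identityˡ (det (A [ p ]≔ w))) ⟩
    det (A [ p ]≔ u) + det (A [ p ]≔ w) ∎

  IsLinear : ∀ {n} → ((Fin n → ℤ) → ℤ) → Set
  IsLinear {n} L = ∀ a b (u w : Fin n → ℤ) → L (λ k → a * u k + b * w k) ≡ a * L u + b * L w

  module LinearFunctional {n} (L : (Fin n → ℤ) → ℤ)
    (L-cong : ∀ {u w} → (∀ k → u k ≡ w k) → L u ≡ L w) (L-linear : IsLinear L) where

    linear-sum : ∀ {m} (c : Fin m → ℤ) (w : Fin m → Fin n → ℤ) →
                 L (λ i → ∑[ k < m ] (c k * w k i)) ≡ ∑[ k < m ] (c k * L (w k))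
    linear-sum {zero} c w = begin
      L (λ _ → + 0)
        ≡⟨ L-linear (+ 0) (+ 0) (λ _ → + 0) (λ _ → + 0) ⟩
      + 0 * L (λ _ → + 0) + + 0 * L (λ _ → + 0)
        ≡⟨ cong₂ _+_ (*-zeroˡ (L (λ _ → + 0))) (*-zeroˡ (L (λ _ → + 0))) ⟩
      + 0 ∎
    linear-sum {suc m} c w = begin
      L (λ i → c zero * w zero i + R i)
        ≡⟨ L-cong (λ i → cong (λ x → c zero * w zero i + x) (sym (*-identityˡ (R i)))) ⟩
      L (λ i → c zero * w zero i + + 1 * R i)
        ≡⟨ L-linear (c zero) (+ 1) (w zero) R ⟩
      c zero * L (w zero) + + 1 * L R
        ≡⟨ cong (λ x → c zero * L (w zero) + x) (trans (*-identityˡ (L R)) (linear-sum (c ∘ suc) (w ∘ suc))) ⟩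
      ∑[ k < suc m ] (c k * L (w k)) ∎
      where
      R : Fin n → ℤ
      R i = ∑[ k < m ] (c (suc k) * w (suc k) i)

    linear-expand : ∀ v → L v ≡ ∑[ k < n ] (v k * L (δ k))
    linear-expand v = trans (L-cong (λ i → sym (sum-δʳ i v))) (linear-sum v δ)

  cofactor : ∀ {n} → Matrix n n → Fin n → Fin n → ℤ
  cofactor A i k = det (A [ i ]≔ δ k)

  det-expand-row : ∀ {n} (A : Matrix n n) i v → det (A [ i ]≔ v) ≡ ∑[ k < n ] (v k * cofactor A i k)
  det-expand-row A i = LinearFunctional.linear-expand
    (λ v → det (A [ i ]≔ v)) (λ u≗w → det-cong ([]≔-cong A i u≗w)) (det-linear A i)

  sgn-suc : ∀ k → sgn (suc k) ≡ - sgn k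
  sgn-suc zero    = refl
  sgn-suc (suc k) = sym (trans (cong -_ (sgn-suc k)) (neg-involutive (sgn k)))

  punchIn-punchOut-comm : ∀ {n} (j l : Fin (suc (suc n))) (j≢l : j ≢ l) (l≢j : l ≢ j) c →
    punchIn j (punchIn (punchOut j≢l) c) ≡ punchIn l (punchIn (punchOut l≢j) c)
  punchIn-punchOut-comm zero    zero    j≢l l≢j c = contradiction refl j≢l
  punchIn-punchOut-comm zero    (suc l) j≢l l≢j c = refl
  punchIn-punchOut-comm (suc j) zero    j≢l l≢j c = refl
  punchIn-punchOut-comm {suc n} (suc j) (suc l) j≢l l≢j zero    = refl
  punchIn-punchOut-comm {suc n} (suc j) (suc l) j≢l l≢j (suc c) =
    cong suc (punchIn-punchOut-comm j l (j≢l ∘ cong suc) (l≢j ∘ cong suc) c)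

  sgn-punchOut : ∀ {n} (j l : Fin (suc (suc n))) (j≢l : j ≢ l) (l≢j : l ≢ j) →
    sgn (toℕ j) * sgn (toℕ (punchOut j≢l)) ≡ - (sgn (toℕ l) * sgn (toℕ (punchOut l≢j)))
  sgn-punchOut zero zero j≢l l≢j = contradiction refl j≢l
  sgn-punchOut zero (suc l) j≢l l≢j = begin
    + 1 * sgn (toℕ l)        ≡⟨ one-neg (sgn (toℕ l)) ⟩
    - (- sgn (toℕ l) * + 1)  ≡⟨ cong (λ s → - (s * + 1)) (sym (sgn-suc (toℕ l))) ⟩
    - (sgn (suc (toℕ l)) * + 1) ∎
    where
    one-neg : ∀ x → + 1 * x ≡ - (- x * + 1)
    one-neg = solve-∀
  sgn-punchOut (suc j) zero j≢l l≢j = begin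
    sgn (suc (toℕ j)) * + 1  ≡⟨ cong (_* + 1) (sgn-suc (toℕ j)) ⟩
    - sgn (toℕ j) * + 1      ≡⟨ neg-one (sgn (toℕ j)) ⟩
    - (+ 1 * sgn (toℕ j)) ∎
    where
    neg-one : ∀ x → - x * + 1 ≡ - (+ 1 * x)
    neg-one = solve-∀
  sgn-punchOut {zero}  (suc zero) (suc zero) j≢l l≢j = contradiction refl j≢l
  sgn-punchOut {suc n} (suc j) (suc l) j≢l l≢j = begin
    sgn (suc (toℕ j)) * sgn (suc (toℕ oj))
      ≡⟨ cong₂ _*_ (sgn-suc (toℕ j)) (sgn-suc (toℕ oj)) ⟩
    - sgn (toℕ j) * - sgn (toℕ oj)
      ≡⟨ neg-neg (sgn (toℕ j)) (sgn (toℕ oj)) ⟩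
    sgn (toℕ j) * sgn (toℕ oj)
      ≡⟨ sgn-punchOut j l (j≢l ∘ cong suc) (l≢j ∘ cong suc) ⟩
    - (sgn (toℕ l) * sgn (toℕ ol))
      ≡⟨ cong -_ (sym (neg-neg (sgn (toℕ l)) (sgn (toℕ ol)))) ⟩
    - (- sgn (toℕ l) * - sgn (toℕ ol))
      ≡⟨ cong -_ (sym (cong₂ _*_ (sgn-suc (toℕ l)) (sgn-suc (toℕ ol)))) ⟩
    - (sgn (suc (toℕ l)) * sgn (suc (toℕ ol))) ∎
    where
    oj ol : Fin (suc n)
    oj = punchOut (j≢l ∘ cong suc)
    ol = punchOut (l≢j ∘ cong suc)
    neg-neg : ∀ x y → - x * - y ≡ x * y
    neg-neg = solve-∀

  sum-neg : ∀ {n} (f : Fin n → ℤ) → ∑[ i < n ] (- f i) ≡ - sum f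
  sum-neg f = begin
    ∑[ i < _ ] (- f i)       ≡⟨ sum-cong-≗ (λ i → sym (-1*i≡-i (f i))) ⟩
    ∑[ i < _ ] (-1ℤ * f i)   ≡⟨ sym (*-distribˡ-sum -1ℤ f) ⟩
    -1ℤ * sum f              ≡⟨ -1*i≡-i (sum f) ⟩
    - sum f ∎

  sum-antisymmetric : ∀ {n} (T : Fin n → Fin n → ℤ) → (∀ j l → T j l ≡ - T l j) →
                      ∑[ j < n ] ∑[ l < n ] T j l ≡ + 0
  sum-antisymmetric {n} T T-anti = x≡-x⇒x≡0 (begin
    ∑[ j < n ] ∑[ l < n ] T j l       ≡⟨ ∑-comm T ⟩
    ∑[ l < n ] ∑[ j < n ] T j l       ≡⟨ sum-cong-≗ (λ l → sum-cong-≗ (λ j → T-anti j l)) ⟩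
    ∑[ l < n ] ∑[ j < n ] (- T l j)   ≡⟨ sum-cong-≗ (λ l → sum-neg (T l)) ⟩
    ∑[ l < n ] (- ∑[ j < n ] T l j)   ≡⟨ sum-neg (λ l → ∑[ j < n ] T l j) ⟩
    - ∑[ l < n ] ∑[ j < n ] T l j ∎)
    where
    x≡-x⇒x≡0 : ∀ {x} → x ≡ - x → x ≡ + 0
    x≡-x⇒x≡0 {x} x≡-x = *-cancelˡ-≡ (+ 2) x (+ 0) (begin
      + 2 * x    ≡⟨ two-times x ⟩
      x + x      ≡⟨ cong (λ y → x + y) x≡-x ⟩
      x + - x    ≡⟨ +-inverseʳ x ⟩
      + 0 ∎)
      where
      two-times : ∀ x → + 2 * x ≡ x + x
      two-times = solve-∀

  laplaceTerm₂ : ∀ {n} → Matrix (suc (suc n)) (suc (suc n)) → Fin (suc (suc n)) → Fin (suc (suc n)) → ℤ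
  laplaceTerm₂ A j l with j Fin.≟ l
  ... | yes _   = + 0
  ... | no  j≢l = sgn (toℕ j) * A zero j *
                  (sgn (toℕ (punchOut j≢l)) * A (suc zero) l * det (minor₀ (minor₀ A j) (punchOut j≢l)))

  laplaceTerm₂-diag : ∀ {n} (A : Matrix (suc (suc n)) (suc (suc n))) j → laplaceTerm₂ A j j ≡ + 0
  laplaceTerm₂-diag A j with j Fin.≟ j
  ... | yes _   = refl
  ... | no  j≢j = contradiction refl j≢j

  laplaceTerm₂-punchIn : ∀ {n} (A : Matrix (suc (suc n)) (suc (suc n))) j k →
    laplaceTerm₂ A j (punchIn j k) ≡
    sgn (toℕ j) * A zero j * (sgn (toℕ k) * A (suc zero) (punchIn j k) * det (minor₀ (minor₀ A j) k))
  laplaceTerm₂-punchIn A j k with j Fin.≟ punchIn j k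
  ... | yes j≡jₖ = contradiction (sym j≡jₖ) (punchInᵢ≢i j k)
  ... | no  j≢jₖ = cong (λ t → sgn (toℕ j) * A zero j *
                               (sgn (toℕ t) * A (suc zero) (punchIn j k) * det (minor₀ (minor₀ A j) t)))
                         (punchIn-injective j _ _ (punchIn-punchOut j≢jₖ))

  laplaceTerm₂-antisym : ∀ {n} (A : Matrix (suc (suc n)) (suc (suc n))) →
    (∀ k → A zero k ≡ A (suc zero) k) → ∀ j l → laplaceTerm₂ A j l ≡ - laplaceTerm₂ A l j
  laplaceTerm₂-antisym A rows₀₁ j l with j Fin.≟ l | l Fin.≟ j
  ... | yes _   | yes _   = refl
  ... | yes j≡l | no  l≢j = contradiction (sym j≡l) l≢j
  ... | no  j≢l | yes l≡j = contradiction (sym l≡j) j≢l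
  ... | no  j≢l | no  l≢j = begin
    sj * A zero j * (sjl * A (suc zero) l * det (minor₀ (minor₀ A j) (punchOut j≢l)))
      ≡⟨ cong₂ (λ a d → sj * A zero j * (sjl * a * d)) (sym (rows₀₁ l))
               (det-cong (λ i c → cong (A (suc (suc i))) (punchIn-punchOut-comm j l j≢l l≢j c))) ⟩
    sj * A zero j * (sjl * A zero l * D)
      ≡⟨ regroup sj (A zero j) sjl (A zero l) D ⟩
    sj * sjl * (A zero j * A zero l * D)
      ≡⟨ cong (_* (A zero j * A zero l * D)) (sgn-punchOut j l j≢l l≢j) ⟩
    - (sl * slj) * (A zero j * A zero l * D)
      ≡⟨ regroup′ sl (A zero l) slj (A zero j) D ⟩
    - (sl * A zero l * (slj * A zero j * D))
      ≡⟨ cong (λ a → - (sl * A zero l * (slj * a * D))) (rows₀₁ j) ⟩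
    - (sl * A zero l * (slj * A (suc zero) j * D)) ∎
    where
    sj sl sjl slj D : ℤ
    sj = sgn (toℕ j)
    sl = sgn (toℕ l)
    sjl = sgn (toℕ (punchOut j≢l))
    slj = sgn (toℕ (punchOut l≢j))
    D = det (minor₀ (minor₀ A l) (punchOut l≢j))
    regroup : ∀ s a t b d → s * a * (t * b * d) ≡ s * t * (a * b * d)
    regroup = solve-∀
    regroup′ : ∀ s b t a d → - (s * t) * (a * b * d) ≡ - (s * b * (t * a * d))
    regroup′ = solve-∀

  sum-punchIn : ∀ {n} (f : Fin (suc n) → ℤ) i → f i ≡ + 0 → sum f ≡ ∑[ k < n ] f (punchIn i k)
  sum-punchIn {n} f i fi≡0 = begin
    sum f                                    ≡⟨ sum-remove {i = i} f ⟩
    f i + ∑[ k < n ] f (punchIn i k)         ≡⟨ cong (_+ ∑[ k < n ] f (punchIn i k)) fi≡0 ⟩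
    + 0 + ∑[ k < n ] f (punchIn i k)         ≡⟨ +-identityˡ _ ⟩
    ∑[ k < n ] f (punchIn i k) ∎

  det-expand₂ : ∀ {n} (A : Matrix (suc (suc n)) (suc (suc n))) →
                det A ≡ ∑[ j < suc (suc n) ] ∑[ l < suc (suc n) ] laplaceTerm₂ A j l
  det-expand₂ {n} A = begin
    det A
      ≡⟨ det-expand A ⟩
    ∑[ j < suc (suc n) ] laplaceTerm A j
      ≡⟨ sum-cong-≗ (λ j → cong (S j *_) (det-expand (minor₀ A j))) ⟩
    ∑[ j < suc (suc n) ] (S j * ∑[ k < suc n ] T j k)
      ≡⟨ sum-cong-≗ (λ j → *-distribˡ-sum (S j) (T j)) ⟩
    ∑[ j < suc (suc n) ] ∑[ k < suc n ] (S j * T j k)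
      ≡⟨ sum-cong-≗ (λ j → sum-cong-≗ (λ k → sym (laplaceTerm₂-punchIn A j k))) ⟩
    ∑[ j < suc (suc n) ] ∑[ k < suc n ] laplaceTerm₂ A j (punchIn j k)
      ≡⟨ sum-cong-≗ (λ j → sym (sum-punchIn (laplaceTerm₂ A j) j (laplaceTerm₂-diag A j))) ⟩
    ∑[ j < suc (suc n) ] ∑[ l < suc (suc n) ] laplaceTerm₂ A j l ∎
    where
    S : Fin (suc (suc n)) → ℤ
    S j = sgn (toℕ j) * A zero j
    T : Fin (suc (suc n)) → Fin (suc n) → ℤ
    T j k = sgn (toℕ k) * A (suc zero) (punchIn j k) * det (minor₀ (minor₀ A j) k)

  det-row₀≡row₁ : ∀ {n} (A : Matrix (suc (suc n)) (suc (suc n))) →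
                  (∀ k → A zero k ≡ A (suc zero) k) → det A ≡ + 0
  det-row₀≡row₁ A rows₀₁ =
    trans (det-expand₂ A) (sum-antisymmetric (laplaceTerm₂ A) (laplaceTerm₂-antisym A rows₀₁))

  bilinear-alternating⇒antisymmetric : ∀ {a} {V : Set a} (_⊕_ : V → V → V) (S : V → V → ℤ) →
    (∀ u u′ w → S (u ⊕ u′) w ≡ S u w + S u′ w) → (∀ u w w′ → S u (w ⊕ w′) ≡ S u w + S u w′) →
    (∀ u → S u u ≡ + 0) → ∀ u w → S u w + S w u ≡ + 0
  bilinear-alternating⇒antisymmetric _⊕_ S additiveˡ additiveʳ alternating u w = begin
    S u w + S w u
      ≡⟨ pad (S u w) (S w u) ⟩
    (+ 0 + S u w) + (S w u + + 0)
      ≡⟨ sym (cong₂ (λ x y → (x + S u w) + (S w u + y)) (alternating u) (alternating w)) ⟩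
    (S u u + S u w) + (S w u + S w w)
      ≡⟨ sym (cong₂ _+_ (additiveʳ u u w) (additiveʳ w u w)) ⟩
    S u (u ⊕ w) + S w (u ⊕ w)
      ≡⟨ sym (additiveˡ u w (u ⊕ w)) ⟩
    S (u ⊕ w) (u ⊕ w)
      ≡⟨ alternating (u ⊕ w) ⟩
    + 0 ∎
    where
    pad : ∀ x y → x + y ≡ (+ 0 + x) + (y + + 0)
    pad = solve-∀

  det-swap-rows : ∀ {n} {p q : Fin n} → p ≢ q →
    (∀ (B : Matrix n n) → (∀ k → B p k ≡ B q k) → det B ≡ + 0) →
    ∀ (A : Matrix n n) u w → det (A [ p ]≔ u [ q ]≔ w) + det (A [ p ]≔ w [ q ]≔ u) ≡ + 0
  det-swap-rows {p = p} {q} p≢q equal⇒0 A = bilinear-alternating⇒antisymmetric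
    (λ u w k → u k + w k) (λ u w → det (A [ p ]≔ u [ q ]≔ w)) additiveˡ additiveʳ alternating
    where
    commute : ∀ u w i k → (A [ p ]≔ u [ q ]≔ w) i k ≡ (A [ q ]≔ w [ p ]≔ u) i k
    commute u w i k = cong-app (updateAt-commutes q p (p≢q ∘ sym) A i) k
    additiveˡ : ∀ u u′ w → det (A [ p ]≔ (λ k → u k + u′ k) [ q ]≔ w) ≡
                           det (A [ p ]≔ u [ q ]≔ w) + det (A [ p ]≔ u′ [ q ]≔ w)
    additiveˡ u u′ w = begin
      det (A [ p ]≔ (λ k → u k + u′ k) [ q ]≔ w)
        ≡⟨ det-cong (commute _ w) ⟩
      det (A [ q ]≔ w [ p ]≔ (λ k → u k + u′ k))
        ≡⟨ det-additive (A [ q ]≔ w) p u u′ ⟩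
      det (A [ q ]≔ w [ p ]≔ u) + det (A [ q ]≔ w [ p ]≔ u′)
        ≡⟨ sym (cong₂ _+_ (det-cong (commute u w)) (det-cong (commute u′ w))) ⟩
      det (A [ p ]≔ u [ q ]≔ w) + det (A [ p ]≔ u′ [ q ]≔ w) ∎
    additiveʳ : ∀ u w w′ → det (A [ p ]≔ u [ q ]≔ (λ k → w k + w′ k)) ≡
                           det (A [ p ]≔ u [ q ]≔ w) + det (A [ p ]≔ u [ q ]≔ w′)
    additiveʳ u = det-additive (A [ p ]≔ u) q
    alternating : ∀ u → det (A [ p ]≔ u [ q ]≔ u) ≡ + 0
    alternating u = equal⇒0 _ (λ k →
      trans ([]≔-minimal (A [ p ]≔ u) u p≢q k)
            (trans ([]≔-updates A p u k) (sym ([]≔-updates (A [ p ]≔ u) q u k))))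

  Alternating : ℕ → Set
  Alternating n = ∀ (A : Matrix n n) {p q} → p ≢ q → (∀ k → A p k ≡ A q k) → det A ≡ + 0

  alternating-tail : ∀ {n} → Alternating n → ∀ (A : Matrix (suc n) (suc n)) {p q} → p ≢ q →
                     (∀ k → A (suc p) k ≡ A (suc q) k) → det A ≡ + 0
  alternating-tail alternating A p≢q rows = trans (det-expand A) (sum-zero _ λ j →
    trans (cong (sgn (toℕ j) * A zero j *_) (alternating (minor₀ A j) p≢q (rows ∘ punchIn j)))
          (*-zeroʳ (sgn (toℕ j) * A zero j)))

  -- Exchanging rows 1 and Q only flips the sign (both lie below row 0, where alternation is already known)
  -- and yields a matrix whose rows 0 and 1 agree.
  det-row₀≡row : ∀ {n} → Alternating (suc n) → ∀ (A : Matrix (suc (suc n)) (suc (suc n))) q →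
                 (∀ k → A zero k ≡ A (suc q) k) → det A ≡ + 0
  det-row₀≡row alternating A zero rows = det-row₀≡row₁ A rows
  det-row₀≡row {suc n} alternating A (suc q) rows = begin
    det A
      ≡⟨ det-cong (λ i k → sym (restore i k)) ⟩
    det (A [ one ]≔ A one [ Q ]≔ A zero)
      ≡⟨ sym (+-identityʳ _) ⟩
    det (A [ one ]≔ A one [ Q ]≔ A zero) + + 0
      ≡⟨ cong (λ x → det (A [ one ]≔ A one [ Q ]≔ A zero) + x)
              (sym (det-row₀≡row₁ (A [ one ]≔ A zero [ Q ]≔ A one) (λ _ → refl))) ⟩
    det (A [ one ]≔ A one [ Q ]≔ A zero) + det (A [ one ]≔ A zero [ Q ]≔ A one)
      ≡⟨ det-swap-rows (λ ()) (λ B → alternating-tail alternating B {zero} {suc q} (λ ())) A (A one) (A zero) ⟩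
    + 0 ∎
    where
    one Q : Fin (suc (suc (suc n)))
    one = suc zero
    Q = suc (suc q)
    restore : ∀ i k → (A [ one ]≔ A one [ Q ]≔ A zero) i k ≡ A i k
    restore i k = trans ([]≔-id (A [ one ]≔ A one) Q (A zero) rows i k) ([]≔-id A one (A one) (λ _ → refl) i k)

  det-alternating : ∀ n → Alternating n
  det-alternating (suc n) A {zero} {zero} p≢q rows = contradiction refl p≢q
  det-alternating (suc (suc n)) A {zero} {suc q} p≢q rows = det-row₀≡row (det-alternating (suc n)) A q rows
  det-alternating (suc (suc n)) A {suc p} {zero} p≢q rows = det-row₀≡row (det-alternating (suc n)) A p (sym ∘ rows)
  det-alternating (suc n) A {suc p} {suc q} p≢q rows = alternating-tail (det-alternating n) A (p≢q ∘ cong suc) rows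

  adjugate-identity : ∀ {n} (A : Matrix n n) i j → ∑[ k < n ] (A j k * cofactor A i k) ≡ δ j i * det A
  adjugate-identity {n} A i j with j Fin.≟ i
  ... | yes refl = begin
    ∑[ k < n ] (A j k * cofactor A j k)  ≡⟨ sym (det-expand-row A j (A j)) ⟩
    det (A [ j ]≔ A j)                   ≡⟨ det-cong ([]≔-id A j (A j) (λ _ → refl)) ⟩
    det A                                ≡⟨ sym (*-identityˡ (det A)) ⟩
    + 1 * det A ∎
  ... | no j≢i = begin
    ∑[ k < n ] (A j k * cofactor A i k)  ≡⟨ sym (det-expand-row A i (A j)) ⟩
    det (A [ i ]≔ A j)                   ≡⟨ det-alternating n (A [ i ]≔ A j) (j≢i ∘ sym) A[i]≔Aj-rows ⟩
    + 0                                  ≡⟨ sym (*-zeroˡ (det A)) ⟩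
    + 0 * det A ∎
    where
    A[i]≔Aj-rows : ∀ k → (A [ i ]≔ A j) i k ≡ (A [ i ]≔ A j) j k
    A[i]≔Aj-rows k = trans ([]≔-updates A i (A j) k) (sym ([]≔-minimal A (A j) j≢i k))

  sign-factor : ∀ x → ∃ λ t → t * x ≡ + ∣ x ∣
  sign-factor (+ n)    = + 1 , *-identityˡ (+ n)
  sign-factor -[1+ n ] = -1ℤ , -1*i≡-i -[1+ n ]

  ℕ-identity⇒ℤ : ∀ a b c e f → a ℕ.+ b ℕ.* c ≡ e ℕ.* f → + a + + b * + c ≡ + e * + f
  ℕ-identity⇒ℤ a b c e f eq = begin
    + a + + b * + c     ≡⟨ cong (λ s → + a + s) (pos-* b c) ⟨
    + a + + (b ℕ.* c)   ≡⟨ pos-+ a (b ℕ.* c) ⟨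
    + (a ℕ.+ b ℕ.* c)   ≡⟨ cong +_ eq ⟩
    + (e ℕ.* f)         ≡⟨ pos-* e f ⟩
    + e * + f ∎

  Bézout-identity⇒ℤ : ∀ {d m n} → Bézout.Identity d m n → ∃₂ λ u v → u * + m + v * + n ≡ + d
  Bézout-identity⇒ℤ {d} {m} {n} (Bézout.Identity.+- x y eq) = + x , - + y , (begin
    + x * + m + - + y * + n       ≡⟨ cong (λ t → t + - + y * + n) (sym (ℕ-identity⇒ℤ d y n x m eq)) ⟩
    + d + + y * + n + - + y * + n ≡⟨ cancel (+ d) (+ y) (+ n) ⟩
    + d ∎)
    where
    cancel : ∀ d y n → d + y * n + - y * n ≡ d
    cancel = solve-∀
  Bézout-identity⇒ℤ {d} {m} {n} (Bézout.Identity.-+ x y eq) = - + x , + y , (begin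
    - + x * + m + + y * + n       ≡⟨ cong (λ t → - + x * + m + t) (sym (ℕ-identity⇒ℤ d x m y n eq)) ⟩
    - + x * + m + (+ d + + x * + m) ≡⟨ cancel (+ d) (+ x) (+ m) ⟩
    + d ∎)
    where
    cancel : ∀ d x m → - x * m + (d + x * m) ≡ d
    cancel = solve-∀

  bezout-family : ∀ {n} (F : Fin n → ℤ) →
           ∃₂ λ g (c : Fin n → ℤ) → ∑[ i < n ] (c i * F i) ≡ + g × (∀ i → g ∣ ∣ F i ∣)
  bezout-family {zero} F = 0 , (λ _ → + 0) , refl , λ ()
  bezout-family {suc n} F with bezout-family (F ∘ suc) | sign-factor (F zero)
  ... | g′ , c′ , c′F≡g′ , g′∣F | t , tF₀≡∣F₀∣ with Bézout.lemma ∣ F zero ∣ g′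
  ... | Bézout.result g gcd identity with Bézout-identity⇒ℤ identity
  ... | u , v , uv≡g = g , c , combination , divides
    where
    c : Fin (suc n) → ℤ
    c zero    = u * t
    c (suc i) = v * c′ i
    combination : ∑[ i < suc n ] (c i * F i) ≡ + g
    combination = begin
      u * t * F zero + ∑[ i < n ] (v * c′ i * F (suc i))
        ≡⟨ cong₂ _+_ (trans (*-assoc u t (F zero)) (cong (u *_) tF₀≡∣F₀∣))
                     (trans (sum-cong-≗ (λ i → *-assoc v (c′ i) (F (suc i))))
                            (sym (*-distribˡ-sum v (λ i → c′ i * F (suc i))))) ⟩
      u * + ∣ F zero ∣ + v * ∑[ i < n ] (c′ i * F (suc i))
        ≡⟨ cong (λ s → u * + ∣ F zero ∣ + v * s) c′F≡g′ ⟩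
      u * + ∣ F zero ∣ + v * + g′
        ≡⟨ uv≡g ⟩
      + g ∎
    divides : ∀ i → g ∣ ∣ F i ∣
    divides zero    = GCD.gcd∣m gcd
    divides (suc i) = ∣-trans (GCD.gcd∣n gcd) (g′∣F i)

  sum-*-sum : ∀ {m n} (a : Fin m → ℤ) (f : Fin n → Fin m → ℤ) →
              ∑[ x < m ] (a x * ∑[ t < n ] f t x) ≡ ∑[ t < n ] ∑[ x < m ] (a x * f t x)
  sum-*-sum a f =
    trans (sum-cong-≗ (λ x → *-distribˡ-sum (a x) (λ t → f t x))) (∑-comm (λ x t → a x * f t x))

  sum-scatter : ∀ {m r} (τ : Fin r → Fin m) (a : Fin m → ℤ) (w : Fin r → ℤ) →
                ∑[ x < m ] (a x * ∑[ k < r ] (δ (τ k) x * w k)) ≡ ∑[ k < r ] (a (τ k) * w k)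
  sum-scatter {m} {r} τ a w = begin
    ∑[ x < m ] (a x * ∑[ k < r ] (δ (τ k) x * w k))
      ≡⟨ sum-*-sum a (λ k x → δ (τ k) x * w k) ⟩
    ∑[ k < r ] ∑[ x < m ] (a x * (δ (τ k) x * w k))
      ≡⟨ sum-cong-≗ (λ k → sum-cong-≗ (λ x → swap (a x) (δ (τ k) x) (w k))) ⟩
    ∑[ k < r ] ∑[ x < m ] (δ (τ k) x * (a x * w k))
      ≡⟨ sum-cong-≗ (λ k → sum-δ (τ k) (λ x → a x * w k)) ⟩
    ∑[ k < r ] (a (τ k) * w k) ∎
    where
    swap : ∀ a d w → a * (d * w) ≡ d * (a * w)
    swap = solve-∀

  selectColumns : ∀ {r m} → Matrix r m → (Fin r → Fin m) → Matrix r r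
  selectColumns M τ a b = M a (τ b)

  scatteredAdjugate : ∀ {r m} → Matrix r m → (Fin r → Fin m) → Matrix m r
  scatteredAdjugate {r} M τ x i = ∑[ k < r ] (δ (τ k) x * cofactor (selectColumns M τ) i k)

  scatteredAdjugate-rightInverse : ∀ {r m} (M : Matrix r m) τ j i →
    ∑[ x < m ] (M j x * scatteredAdjugate M τ x i) ≡ δ j i * det (selectColumns M τ)
  scatteredAdjugate-rightInverse M τ j i =
    trans (sum-scatter τ (M j) (λ k → cofactor (selectColumns M τ) i k))
          (adjugate-identity (selectColumns M τ) i j)

  rightInverse-combination : ∀ {r m s} (M : Matrix r m) (N : Fin s → Matrix m r) (D c : Fin s → ℤ) →
    (∀ t j i → ∑[ x < m ] (M j x * N t x i) ≡ δ j i * D t) → ∑[ t < s ] (c t * D t) ≡ + 1 →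
    ∀ j i → ∑[ x < m ] (M j x * ∑[ t < s ] (c t * N t x i)) ≡ δ j i
  rightInverse-combination {m = m} {s} M N D c MNₜ≡DₜI cD≡1 j i = begin
    ∑[ x < m ] (M j x * ∑[ t < s ] (c t * N t x i))
      ≡⟨ sum-*-sum (M j) (λ t x → c t * N t x i) ⟩
    ∑[ t < s ] ∑[ x < m ] (M j x * (c t * N t x i))
      ≡⟨ sum-cong-≗ (λ t → sum-cong-≗ (λ x → swap (M j x) (c t) (N t x i))) ⟩
    ∑[ t < s ] ∑[ x < m ] (c t * (M j x * N t x i))
      ≡⟨ sum-cong-≗ (λ t → *-distribˡ-sum (c t) (λ x → M j x * N t x i)) ⟨
    ∑[ t < s ] (c t * ∑[ x < m ] (M j x * N t x i))
      ≡⟨ sum-cong-≗ (λ t → trans (cong (c t *_) (MNₜ≡DₜI t j i)) (swap (c t) (δ j i) (D t))) ⟩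
    ∑[ t < s ] (δ j i * (c t * D t))
      ≡⟨ *-distribˡ-sum (δ j i) (λ t → c t * D t) ⟨
    δ j i * ∑[ t < s ] (c t * D t)
      ≡⟨ cong (δ j i *_) cD≡1 ⟩
    δ j i * + 1
      ≡⟨ *-identityʳ (δ j i) ⟩
    δ j i ∎
    where
    swap : ∀ a c s → a * (c * s) ≡ c * (a * s)
    swap = solve-∀

  -- Bézout runs over all m ^ r maps Fin r → Fin m; the increasing ones among them give the minors in d_r(M).
  minors-combination : ∀ {r m} (M : Matrix r m) → IsGcdOfNonzeroMinors M 1 →
    ∃ λ (c : Fin (m ℕ.^ r) → ℤ) → ∑[ t < m ℕ.^ r ] (c t * det (selectColumns M (finToFun t))) ≡ + 1
  minors-combination M (_ , greatest) with bezout-family (λ t → det (selectColumns M (finToFun t)))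
  ... | g , c , cD≡g , g∣D = c , trans cD≡g (cong +_ (∣1⇒≡1 g∣1))
    where
    g∣1 : g ∣ 1
    g∣1 = greatest g λ (σ , _) _ →
      subst (λ d → g ∣ ∣ d ∣) (det-cong (λ a b → cong (M a) (finToFun-funToFin σ b))) (g∣D (funToFin σ))

  rightInverse : ∀ {r m} (M : Matrix r m) → IsGcdOfNonzeroMinors M 1 →
                 ∃ λ (N : Matrix m r) → ∀ j i → ∑[ x < m ] (M j x * N x i) ≡ δ j i
  rightInverse {r} {m} M gcd≡1 with minors-combination M gcd≡1
  ... | c , cD≡1 = (λ x i → ∑[ t < m ℕ.^ r ] (c t * scatteredAdjugate M (finToFun t) x i)) ,
                   rightInverse-combination M (scatteredAdjugate M ∘ finToFun) _ c
                     (λ t → scatteredAdjugate-rightInverse M (finToFun t)) cD≡1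

open IntegerMatrices

ℤ-ind : ∀ {p} (P : ℤ → Set p) → P (+ 0) →
        (∀ a → P a → P (+ 1 + a)) → (∀ a → P a → P (-1ℤ + a)) → ∀ a → P a
ℤ-ind P P0 P-suc P-pred (+ zero)       = P0
ℤ-ind P P0 P-suc P-pred (+ suc n)      = P-suc (+ n) (ℤ-ind P P0 P-suc P-pred (+ n))
ℤ-ind P P0 P-suc P-pred -[1+ zero ]    = P-pred (+ 0) P0
ℤ-ind P P0 P-suc P-pred -[1+ suc n ]   = P-pred -[1+ n ] (ℤ-ind P P0 P-suc P-pred -[1+ n ])

module ℤModule {c ℓ} (G : AbelianGroup c ℓ) where

  open AbelianGroup G
  open AbelianGroupProperties G using (⁻¹-∙-comm; ε⁻¹≈ε; inverseˡ-unique; identityˡ-unique)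
  open CommutativeMonoidMult commutativeMonoid using (×-congʳ; ×-distrib-+)
  open CommutativeMonoidSum commutativeMonoid public using () renaming (sum to ∑ᴳ; sum-cong-≋ to ∑ᴳ-cong)
  open CommutativeMonoidSum commutativeMonoid using ()
    renaming (∑-distrib-+ to ∑ᴳ-distrib-∙; ∑-comm to ∑ᴳ-comm; sum-remove to ∑ᴳ-remove;
              sum-replicate-zero to ∑ᴳ-replicate-ε)
  open SetoidReasoning setoid

  infixr 7.5 _⋆_
  _⋆_ : ℤ → Carrier → Carrier
  _⋆_ = _·_ G

  ⋆-congʳ : ∀ a {x y} → x ≈ y → a ⋆ x ≈ a ⋆ y
  ⋆-congʳ (+ n)    x≈y = ×-congʳ n x≈y
  ⋆-congʳ -[1+ n ] x≈y = ⁻¹-cong (×-congʳ (suc n) x≈y)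

  ⋆-distrib-∙ : ∀ a x y → a ⋆ (x ∙ y) ≈ a ⋆ x ∙ a ⋆ y
  ⋆-distrib-∙ (+ n)    x y = ×-distrib-+ x y n
  ⋆-distrib-∙ -[1+ n ] x y = trans (⁻¹-cong (×-distrib-+ x y (suc n))) (sym (⁻¹-∙-comm _ _))

  ⋆-ε : ∀ a → a ⋆ ε ≈ ε
  ⋆-ε a = identityˡ-unique (a ⋆ ε) (a ⋆ ε) (begin
    a ⋆ ε ∙ a ⋆ ε  ≈⟨ ⋆-distrib-∙ a ε ε ⟨
    a ⋆ (ε ∙ ε)    ≈⟨ ⋆-congʳ a (identityˡ ε) ⟩
    a ⋆ ε ∎)

  ⋆-⁻¹ : ∀ a x → a ⋆ x ⁻¹ ≈ (a ⋆ x) ⁻¹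
  ⋆-⁻¹ a x = inverseˡ-unique (a ⋆ x ⁻¹) (a ⋆ x) (begin
    a ⋆ x ⁻¹ ∙ a ⋆ x  ≈⟨ ⋆-distrib-∙ a (x ⁻¹) x ⟨
    a ⋆ (x ⁻¹ ∙ x)    ≈⟨ ⋆-congʳ a (inverseˡ x) ⟩
    a ⋆ ε             ≈⟨ ⋆-ε a ⟩
    ε ∎)

  private
    x∙[x∙y]⁻¹≈y⁻¹ : ∀ x y → x ∙ (x ∙ y) ⁻¹ ≈ y ⁻¹
    x∙[x∙y]⁻¹≈y⁻¹ x y = begin
      x ∙ (x ∙ y) ⁻¹       ≈⟨ ∙-congˡ (⁻¹-∙-comm x y) ⟨
      x ∙ (x ⁻¹ ∙ y ⁻¹)    ≈⟨ assoc x (x ⁻¹) (y ⁻¹) ⟨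
      x ∙ x ⁻¹ ∙ y ⁻¹      ≈⟨ ∙-congʳ (inverseʳ x) ⟩
      ε ∙ y ⁻¹             ≈⟨ identityˡ (y ⁻¹) ⟩
      y ⁻¹ ∎

    1+[-1+a]≡a : ∀ a → + 1 + (-1ℤ + a) ≡ a
    1+[-1+a]≡a = solve-∀

  ⋆-suc : ∀ a x → (+ 1 + a) ⋆ x ≈ x ∙ a ⋆ x
  ⋆-suc (+ n)          x = refl
  ⋆-suc -[1+ zero ]    x = trans (sym ε⁻¹≈ε) (sym (x∙[x∙y]⁻¹≈y⁻¹ x ε))
  ⋆-suc -[1+ suc n ]   x = sym (x∙[x∙y]⁻¹≈y⁻¹ x (+ suc n ⋆ x))

  ⋆-pred : ∀ a x → (-1ℤ + a) ⋆ x ≈ x ⁻¹ ∙ a ⋆ x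
  ⋆-pred a x = begin
    b ⋆ x                 ≈⟨ identityˡ (b ⋆ x) ⟨
    ε ∙ b ⋆ x             ≈⟨ ∙-congʳ (inverseˡ x) ⟨
    x ⁻¹ ∙ x ∙ b ⋆ x      ≈⟨ assoc (x ⁻¹) x (b ⋆ x) ⟩
    x ⁻¹ ∙ (x ∙ b ⋆ x)    ≈⟨ ∙-congˡ (⋆-suc b x) ⟨
    x ⁻¹ ∙ (+ 1 + b) ⋆ x  ≡⟨ ≡.cong (λ a → x ⁻¹ ∙ a ⋆ x) (1+[-1+a]≡a a) ⟩
    x ⁻¹ ∙ a ⋆ x ∎
    where
    b : ℤ
    b = -1ℤ + a

  ⋆-distribʳ-+ : ∀ a b x → (a + b) ⋆ x ≈ a ⋆ x ∙ b ⋆ x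
  ⋆-distribʳ-+ a b x = ℤ-ind (λ a → (a + b) ⋆ x ≈ a ⋆ x ∙ b ⋆ x)
    (trans (reflexive (≡.cong (_⋆ x) (+-identityˡ b))) (sym (identityˡ (b ⋆ x))))
    (shift (+ 1) x (λ c → ⋆-suc c x)) (shift -1ℤ (x ⁻¹) (λ c → ⋆-pred c x)) a
    where
    shift : ∀ u g → (∀ c → (u + c) ⋆ x ≈ g ∙ c ⋆ x) → ∀ a →
            (a + b) ⋆ x ≈ a ⋆ x ∙ b ⋆ x → (u + a + b) ⋆ x ≈ (u + a) ⋆ x ∙ b ⋆ x
    shift u g u⋆ a IH = begin
      (u + a + b) ⋆ x         ≡⟨ ≡.cong (_⋆ x) (+-assoc u a b) ⟩
      (u + (a + b)) ⋆ x       ≈⟨ u⋆ (a + b) ⟩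
      g ∙ (a + b) ⋆ x         ≈⟨ ∙-congˡ IH ⟩
      g ∙ (a ⋆ x ∙ b ⋆ x)     ≈⟨ assoc g (a ⋆ x) (b ⋆ x) ⟨
      g ∙ a ⋆ x ∙ b ⋆ x       ≈⟨ ∙-congʳ (u⋆ a) ⟨
      (u + a) ⋆ x ∙ b ⋆ x ∎

  ⋆-neg : ∀ a x → (- a) ⋆ x ≈ (a ⋆ x) ⁻¹
  ⋆-neg a x = inverseˡ-unique ((- a) ⋆ x) (a ⋆ x) (begin
    (- a) ⋆ x ∙ a ⋆ x  ≈⟨ ⋆-distribʳ-+ (- a) a x ⟨
    (- a + a) ⋆ x      ≡⟨ ≡.cong (_⋆ x) (+-inverseˡ a) ⟩
    ε ∎)

  ⋆-assoc : ∀ a b x → (a * b) ⋆ x ≈ a ⋆ b ⋆ x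
  ⋆-assoc a b x = ℤ-ind (λ a → (a * b) ⋆ x ≈ a ⋆ b ⋆ x) refl
    (shift (+ 1) (b ⋆ x) (reflexive (≡.cong (_⋆ x) (*-identityˡ b))) (λ c → ⋆-suc c (b ⋆ x)))
    (shift -1ℤ ((b ⋆ x) ⁻¹) (trans (reflexive (≡.cong (_⋆ x) (-1*i≡-i b))) (⋆-neg b x))
           (λ c → ⋆-pred c (b ⋆ x)))
    a
    where
    shift : ∀ u g → (u * b) ⋆ x ≈ g → (∀ c → (u + c) ⋆ b ⋆ x ≈ g ∙ c ⋆ b ⋆ x) → ∀ a →
            (a * b) ⋆ x ≈ a ⋆ b ⋆ x → ((u + a) * b) ⋆ x ≈ (u + a) ⋆ b ⋆ x
    shift u g ub⋆ u⋆ a IH = begin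
      ((u + a) * b) ⋆ x         ≡⟨ ≡.cong (_⋆ x) (*-distribʳ-+ b u a) ⟩
      (u * b + a * b) ⋆ x       ≈⟨ ⋆-distribʳ-+ (u * b) (a * b) x ⟩
      (u * b) ⋆ x ∙ (a * b) ⋆ x ≈⟨ ∙-cong ub⋆ IH ⟩
      g ∙ a ⋆ b ⋆ x             ≈⟨ u⋆ a ⟨
      (u + a) ⋆ b ⋆ x ∎

  ΣG≡∑ᴳ : ∀ {n} (f : Fin n → Carrier) → ΣG G f ≡ ∑ᴳ f
  ΣG≡∑ᴳ {zero}  f = ≡.refl
  ΣG≡∑ᴳ {suc n} f = ≡.cong (f zero ∙_) (ΣG≡∑ᴳ (f ∘ suc))

  ⋆-distrib-∑ᴳ : ∀ {n} a (f : Fin n → Carrier) → a ⋆ ∑ᴳ f ≈ ∑ᴳ (λ i → a ⋆ f i)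
  ⋆-distrib-∑ᴳ {zero}  a f = ⋆-ε a
  ⋆-distrib-∑ᴳ {suc n} a f =
    trans (⋆-distrib-∙ a (f zero) (∑ᴳ (f ∘ suc))) (∙-congˡ (⋆-distrib-∑ᴳ a (f ∘ suc)))

  ∑-distrib-⋆ : ∀ {n} (a : Fin n → ℤ) x → sum a ⋆ x ≈ ∑ᴳ (λ i → a i ⋆ x)
  ∑-distrib-⋆ {zero}  a x = refl
  ∑-distrib-⋆ {suc n} a x = trans (⋆-distribʳ-+ (a zero) (sum (a ∘ suc)) x) (∙-congˡ (∑-distrib-⋆ (a ∘ suc) x))

  ∑ᴳ-⁻¹ : ∀ {n} (f : Fin n → Carrier) → ∑ᴳ (λ i → f i ⁻¹) ≈ (∑ᴳ f) ⁻¹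
  ∑ᴳ-⁻¹ {zero}  f = sym ε⁻¹≈ε
  ∑ᴳ-⁻¹ {suc n} f = trans (∙-congˡ (∑ᴳ-⁻¹ (f ∘ suc))) (⁻¹-∙-comm (f zero) (∑ᴳ (f ∘ suc)))

  ∑ᴳ-ε : ∀ {n} (f : Fin n → Carrier) → (∀ i → f i ≈ ε) → ∑ᴳ f ≈ ε
  ∑ᴳ-ε {n} f f≈ε = trans (∑ᴳ-cong f≈ε) (∑ᴳ-replicate-ε n)

  ∑ᴳ-δ : ∀ {n} i (z : Fin n → Carrier) → ∑ᴳ (λ k → δ i k ⋆ z k) ≈ z i
  ∑ᴳ-δ {suc n} i z = begin
    ∑ᴳ (λ k → δ i k ⋆ z k)
      ≈⟨ ∑ᴳ-remove {i = i} (λ k → δ i k ⋆ z k) ⟩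
    δ i i ⋆ z i ∙ ∑ᴳ (λ k → δ i (punchIn i k) ⋆ z (punchIn i k))
      ≈⟨ ∙-cong (reflexive (≡.cong (_⋆ z i) (δ-diag i)))
                (∑ᴳ-ε _ (λ k → reflexive (≡.cong (_⋆ z (punchIn i k)) (δ-≢ (punchInᵢ≢i i k ∘ ≡.sym))))) ⟩
    (z i ∙ ε) ∙ ε
      ≈⟨ ∙-congʳ (identityʳ (z i)) ⟩
    z i ∙ ε
      ≈⟨ identityʳ (z i) ⟩
    z i ∎

  infixr 7.5 _⊛_
  _⊛_ : ∀ {r m} → Matrix r m → (Fin m → Carrier) → Fin r → Carrier
  (M ⊛ x) i = ∑ᴳ (λ j → M i j ⋆ x j)

  ⊛-assoc : ∀ {r m s} (M : Matrix r m) (N : Matrix m s) z i →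
            (M ⊛ N ⊛ z) i ≈ ((λ i k → ∑[ j < m ] (M i j * N j k)) ⊛ z) i
  ⊛-assoc {m = m} M N z i = begin
    ∑ᴳ (λ j → M i j ⋆ ∑ᴳ (λ k → N j k ⋆ z k))
      ≈⟨ ∑ᴳ-cong (λ j → trans (⋆-distrib-∑ᴳ (M i j) (λ k → N j k ⋆ z k))
                              (∑ᴳ-cong (λ k → sym (⋆-assoc (M i j) (N j k) (z k))))) ⟩
    ∑ᴳ (λ j → ∑ᴳ (λ k → (M i j * N j k) ⋆ z k))
      ≈⟨ ∑ᴳ-comm (λ j k → (M i j * N j k) ⋆ z k) ⟩
    ∑ᴳ (λ k → ∑ᴳ (λ j → (M i j * N j k) ⋆ z k))
      ≈⟨ ∑ᴳ-cong (λ k → ∑-distrib-⋆ (λ j → M i j * N j k) (z k)) ⟨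
    ∑ᴳ (λ k → (∑[ j < m ] (M i j * N j k)) ⋆ z k) ∎

  rightInverse-⊛ : ∀ {r m} (M : Matrix r m) (N : Matrix m r) →
                   (∀ j i → ∑[ x < m ] (M j x * N x i) ≡ δ j i) → ∀ z i → (M ⊛ N ⊛ z) i ≈ z i
  rightInverse-⊛ M N MN≡I z i = begin
    (M ⊛ N ⊛ z) i                                 ≈⟨ ⊛-assoc M N z i ⟩
    ∑ᴳ (λ k → (∑[ x < _ ] (M i x * N x k)) ⋆ z k)  ≈⟨ ∑ᴳ-cong (λ k → reflexive (≡.cong (_⋆ z k) (MN≡I i k))) ⟩
    ∑ᴳ (λ k → δ i k ⋆ z k)                         ≈⟨ ∑ᴳ-δ i z ⟩
    z i ∎

  ⊛-∙⁻¹ : ∀ {r m} (M : Matrix r m) x w i → (M ⊛ (λ j → x j ∙ w j ⁻¹)) i ≈ (M ⊛ x) i ∙ ((M ⊛ w) i) ⁻¹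
  ⊛-∙⁻¹ M x w i = begin
    ∑ᴳ (λ j → M i j ⋆ (x j ∙ w j ⁻¹))
      ≈⟨ ∑ᴳ-cong (λ j → trans (⋆-distrib-∙ (M i j) (x j) (w j ⁻¹)) (∙-congˡ (⋆-⁻¹ (M i j) (w j)))) ⟩
    ∑ᴳ (λ j → M i j ⋆ x j ∙ (M i j ⋆ w j) ⁻¹)
      ≈⟨ ∑ᴳ-distrib-∙ (λ j → M i j ⋆ x j) (λ j → (M i j ⋆ w j) ⁻¹) ⟩
    (M ⊛ x) i ∙ ∑ᴳ (λ j → (M i j ⋆ w j) ⁻¹)
      ≈⟨ ∙-congˡ (∑ᴳ-⁻¹ (λ j → M i j ⋆ w j)) ⟩
    (M ⊛ x) i ∙ ((M ⊛ w) i) ⁻¹ ∎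

  ⊛-cong : ∀ {r m} (M : Matrix r m) {x y} → (∀ j → x j ≈ y j) → ∀ i → (M ⊛ x) i ≈ (M ⊛ y) i
  ⊛-cong M x≈y i = ∑ᴳ-cong (λ j → ⋆-congʳ (M i j) (x≈y j))

  ⊛-ε : ∀ {r m} (M : Matrix r m) {x} → (∀ j → x j ≈ ε) → ∀ i → (M ⊛ x) i ≈ ε
  ⊛-ε M {x} x≈ε i = ∑ᴳ-ε (λ j → M i j ⋆ x j) (λ j → trans (⋆-congʳ (M i j) (x≈ε j)) (⋆-ε (M i j)))

  InKer⇒⊛≈ε : ∀ {r m} (M : Matrix r m) {x} → InKer G M x → ∀ i → (M ⊛ x) i ≈ ε
  InKer⇒⊛≈ε M {x} x∈ker i = trans (reflexive (≡.sym (ΣG≡∑ᴳ (λ j → M i j ⋆ x j)))) (x∈ker i)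

  ⊛≈ε⇒InKer : ∀ {r m} (M : Matrix r m) {x} → (∀ i → (M ⊛ x) i ≈ ε) → InKer G M x
  ⊛≈ε⇒InKer M {x} Mx≈ε i = trans (reflexive (ΣG≡∑ᴳ (λ j → M i j ⋆ x j))) (Mx≈ε i)

module ℤModuleHomomorphism {c₁ ℓ₁ c₂ ℓ₂} (G : AbelianGroup c₁ ℓ₁) (H : AbelianGroup c₂ ℓ₂)
  {θ : AbelianGroup.Carrier G → AbelianGroup.Carrier H} (θ-hom : IsHom G H θ) where

  private
    module G = AbelianGroup G
    module ℤG = ℤModule G
    module ℤH = ℤModule H
  open AbelianGroup H
  open GroupMorphisms.IsGroupHomomorphism θ-hom

  θ-⋆ : ∀ a x → θ (a ℤG.⋆ x) ≈ a ℤH.⋆ θ x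
  θ-⋆ (+ n)    x = θ-× n
    where
    θ-× : ∀ n → θ (+ n ℤG.⋆ x) ≈ + n ℤH.⋆ θ x
    θ-× zero    = ε-homo
    θ-× (suc n) = trans (homo x (+ n ℤG.⋆ x)) (∙-congˡ (θ-× n))
  θ-⋆ -[1+ n ] x = trans (⁻¹-homo (+ suc n ℤG.⋆ x)) (⁻¹-cong (θ-⋆ (+ suc n) x))

  θ-∑ : ∀ {n} (f : Fin n → G.Carrier) → θ (ℤG.∑ᴳ f) ≈ ℤH.∑ᴳ (θ ∘ f)
  θ-∑ {zero}  f = ε-homo
  θ-∑ {suc n} f = trans (homo (f zero) (ℤG.∑ᴳ (f ∘ suc))) (∙-congˡ (θ-∑ (f ∘ suc)))

  θ-⊛ : ∀ {r m} (M : Matrix r m) x i → θ ((M ℤG.⊛ x) i) ≈ (M ℤH.⊛ (θ ∘ x)) i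
  θ-⊛ M x i = trans (θ-∑ (λ j → M i j ℤG.⋆ x j)) (ℤH.∑ᴳ-cong (λ j → θ-⋆ (M i j) (x j)))

lemmaA3 : ∀ {r m : ℕ} (M : Matrix r m) →
    HasFullRowRank M →
    IsGcdOfNonzeroMinors M 1 →
    ∀ {c₁ ℓ₁ c₂ ℓ₂} (G : AbelianGroup c₁ ℓ₁) (H : AbelianGroup c₂ ℓ₂)
    (θ : AbelianGroup.Carrier G → AbelianGroup.Carrier H) →
    IsHom G H θ →
    (∀ h → ∃ λ g → AbelianGroup._≈_ H (θ g) h) →
    ∀ (y : Fin m → AbelianGroup.Carrier H) → InKer H M y →
    ∃ λ (x : Fin m → AbelianGroup.Carrier G) →
    InKer G M x × (∀ j → AbelianGroup._≈_ H (θ (x j)) (y j))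
lemmaA3 {r} {m} M _ gcd≡1 G H θ θ-hom θ-onto y y∈ker = x , ℤG.⊛≈ε⇒InKer M Mx≈ε , θx≈y
  where
  module G = AbelianGroup G
  module H = AbelianGroup H
  module ℤG = ℤModule G
  module ℤH = ℤModule H
  open ℤModuleHomomorphism G H θ-hom
  open GroupMorphisms.IsGroupHomomorphism θ-hom
  open SetoidReasoning H.setoid
  N : Matrix m r
  N = proj₁ (rightInverse M gcd≡1)
  MN≡I : ∀ j i → ∑[ k < m ] (M j k * N k i) ≡ δ j i
  MN≡I = proj₂ (rightInverse M gcd≡1)
  x₀ : Fin m → G.Carrier
  x₀ j = proj₁ (θ-onto (y j))
  z : Fin r → G.Carrier
  z = M ℤG.⊛ x₀
  w x : Fin m → G.Carrier
  w = N ℤG.⊛ z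
  x j = x₀ j G.∙ w j G.⁻¹
  θz≈ε : ∀ i → θ (z i) H.≈ H.ε
  θz≈ε i = H.trans (θ-⊛ M x₀ i)
           (H.trans (ℤH.⊛-cong M (λ j → proj₂ (θ-onto (y j))) i) (ℤH.InKer⇒⊛≈ε M y∈ker i))
  Mx≈ε : ∀ i → (M ℤG.⊛ x) i G.≈ G.ε
  Mx≈ε i = G.trans (ℤG.⊛-∙⁻¹ M x₀ w i)
           (G.trans (G.∙-congˡ (G.⁻¹-cong (ℤG.rightInverse-⊛ M N MN≡I z i))) (G.inverseʳ (z i)))
  θx≈y : ∀ j → θ (x j) H.≈ y j
  θx≈y j = begin
    θ (x₀ j G.∙ w j G.⁻¹)       ≈⟨ homo (x₀ j) (w j G.⁻¹) ⟩
    θ (x₀ j) H.∙ θ (w j G.⁻¹)   ≈⟨ H.∙-cong (proj₂ (θ-onto (y j))) (⁻¹-homo (w j)) ⟩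
    y j H.∙ θ (w j) H.⁻¹        ≈⟨ H.∙-congˡ (H.⁻¹-cong (H.trans (θ-⊛ N z j) (ℤH.⊛-ε N θz≈ε j))) ⟩
    y j H.∙ H.ε H.⁻¹            ≈⟨ H.∙-congˡ (AbelianGroupProperties.ε⁻¹≈ε H) ⟩
    y j H.∙ H.ε                 ≈⟨ H.identityʳ (y j) ⟩
    y j ∎
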